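{- Let $G$ be a connected, claw-free, cubic graph of order $n$ with $G \ne K_4$. Then $Z(G) \le \frac{2}{5}n + 1$.
   Context: All graphs are finite and simple. A graph is cubic if every vertex has degree $3$, and claw-free if it contains no induced subgraph isomorphic to $K_{1,3}$. Zero forcing: given a set $S\subseteq V(G)$ of initially colored vertices (all others uncolored), repeatedly apply the rule: if a colored vertex has exactly one uncolored neighbor, that neighbor becomes colored. $S$ is a zero forcing set if iterating this rule eventually colors all of $V(G)$. $Z(G)$, the zero forcing number, is the minimum cardinality of a zero forcing set of $G$. -}

module Defs where

open import Data.Nat using (ℕ; _+_; _*_; _≤_)
open import Data.Bool using (Bool; true; false)
open import Data.Fin using (Fin)
open import Data.Fin.Subset using (Subset; _∈_; ∣_∣)
open import Data.Vec using (tabulate)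
open import Data.Product using (Σ; _×_; _,_)
open import Relation.Binary.PropositionalEquality using (_≡_; _≢_)
open import Relation.Nullary using (¬_)
open import Function.Bundles using (_↔_; _⇔_; Inverse)

record Graph (n : ℕ) : Set where
  field
    adj   : Fin n → Fin n → Bool
    sym   : ∀ u v → adj u v ≡ adj v u
    irrefl : ∀ v → adj v v ≡ false

open Graph public

Adj : ∀ {n} → Graph n → Fin n → Fin n → Set
Adj G u v = adj G u v ≡ true

N : ∀ {n} → Graph n → Fin n → Subset n
N G v = tabulate (adj G v)

degree : ∀ {n} → Graph n → Fin n → ℕ
degree G v = ∣ N G v ∣

Cubic : ∀ {n} → Graph n → Set
Cubic G = ∀ v → degree G v ≡ 3

ClawFree : ∀ {n} → Graph n → Set
ClawFree {n} G = ∀ (c a b d : Fin n) →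
  Adj G c a → Adj G c b → Adj G c d →
  a ≢ b → a ≢ d → b ≢ d →
  ¬ (¬ Adj G a b × ¬ Adj G a d × ¬ Adj G b d)

data Reach {n} (G : Graph n) (u : Fin n) : Fin n → Set where
  here : Reach G u u
  step : ∀ {v w} → Reach G u v → Adj G v w → Reach G u w

Connected : ∀ {n} → Graph n → Set
Connected {n} G = ∀ (u v : Fin n) → Reach G u v

IsK4 : ∀ {n} → Graph n → Set
IsK4 {n} G = Σ (Fin n ↔ Fin 4) λ f →
  ∀ (u v : Fin n) → Adj G u v ⇔ (Inverse.to f u ≢ Inverse.to f v)

-- Zero forcing: the set of vertices eventually coloured from S, as the least
-- set containing S and closed under the colour-change rule
-- (a coloured u all of whose neighbours other than v are coloured forces v).
data Colored {n} (G : Graph n) (S : Subset n) : Fin n → Set where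
  init  : ∀ {v} → v ∈ S → Colored G S v
  force : ∀ {u v} → Colored G S u → Adj G u v →
          (∀ w → Adj G u w → w ≢ v → Colored G S w) → Colored G S v

IsZeroForcingSet : ∀ {n} → Graph n → Subset n → Set
IsZeroForcingSet G S = ∀ v → Colored G S v

module Submission where

-- Zero forcing is run greedily while tracking the potential Φ = Σᵥ ψ(v), where ψ(v) is 0 for an
-- uncoloured vertex, 1 for a coloured vertex with an uncoloured neighbour and 2 otherwise, so
-- Φ ≤ 2n with equality exactly when every vertex is coloured. A forcing move raises Φ by at least 2
-- at no cost. When no vertex can force, connectivity yields a coloured x with an uncoloured
-- neighbour y; x then has a second uncoloured neighbour z and, by an invariant kept throughout, a
-- coloured neighbour w. Since G is claw-free, some edge joins two of w, y, z, and in each resulting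
-- configuration adding y to the seeds and forcing a few vertices raises Φ by at least 6. To start,
-- take a vertex x with adjacent neighbours p, q and third neighbour r: the seeds x, p, r give Φ ≥ 9
-- unless x, p, q, r span a K₄, which in a connected cubic graph is all of G. Every later seed comes
-- with a gain of at least 6 ≥ 5, so in the end 5 ∣S∣ ≤ Φ + 5 = 2n + 5.

open import Defs hiding (sym)

open import Data.Bool using (Bool; true; false; _∨_; if_then_else_)
import Data.Bool as B
open import Data.Bool.Properties using (∨-zeroʳ; ∨-identityʳ; ¬-not)
open import Data.Empty using (⊥; ⊥-elim)
open import Data.Fin using (Fin; zero; suc)
open import Data.Fin.Patterns using (0F; 1F; 2F; 3F)
open import Data.Fin.Properties using (_≟_)
import Data.Fin.Properties as Fin
open import Data.Fin.Subset using (Subset; ∣_∣)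
open import Data.List using (List; []; _∷_; map; length)
open import Data.List.Membership.Propositional using (_∈_; _∉_)
open import Data.List.Relation.Unary.All using (All; []; _∷_)
import Data.List.Relation.Unary.All as All
open import Data.List.Relation.Unary.AllPairs using (AllPairs; []; _∷_)
open import Data.List.Relation.Unary.Any using (here; there; any?)
open import Data.Nat using (ℕ; zero; suc; _+_; _*_; _≤_; _<_; z≤n; s≤s)
open import Data.Nat.ListAction using (sum)
open import Data.Nat.Properties
  using ( +-0-monoid; +-commutativeSemigroup; module ≤-Reasoning
        ; ≤-refl; ≤-reflexive; ≤-trans; <⇒≱; n≤1+n; m≤m+n; m≤n+m
        ; +-assoc; +-comm; +-identityʳ; +-suc; +-mono-≤; +-monoˡ-≤; +-monoʳ-≤; +-cancelˡ-≤
        ; *-comm; *-zeroʳ; *-distribˡ-+; *-monoʳ-≤; *-cancelˡ-< )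
open import Data.Product using (Σ; ∃-syntax; _×_; _,_; proj₁; proj₂)
open import Data.Sum using (_⊎_; inj₁; inj₂; [_,_]′)
import Data.Sum as Sum
open import Data.Vec using (tabulate; [])
open import Data.Vec.Properties using (lookup∘tabulate; []=⇒lookup; lookup⇒[]=)
open import Function using (_∘_; const)
open import Function.Bundles using (mk⤖; mk⇔)
open import Function.Properties.Bijection using (⤖⇒↔)
open import Function.Properties.Inverse using (↔-sym)
open import Relation.Binary.PropositionalEquality
open import Relation.Nullary using (¬_; Dec; yes; no; does; ¬?; _×-dec_; _→-dec_)
open import Relation.Nullary.Decidable using (dec-true; dec-false)
open import Relation.Nullary.Negation using (contradiction)

open import Algebra.Properties.CommutativeSemigroup +-commutativeSemigroup using (interchange)
open import Algebra.Properties.Monoid.Sum +-0-monoid using (sum-cong-≗) renaming (sum to ∑)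

fromBool : Bool → ℕ
fromBool b = if b then 1 else 0

_↦_ : ∀ {n} → Fin n → ℕ → Fin n → ℕ
(a ↦ d) v = if does (v ≟ a) then d else 0

∑-mono-≤ : ∀ {n} {f g : Fin n → ℕ} → (∀ v → f v ≤ g v) → ∑ f ≤ ∑ g
∑-mono-≤ {zero}  f≤g = z≤n
∑-mono-≤ {suc n} f≤g = +-mono-≤ (f≤g zero) (∑-mono-≤ (f≤g ∘ suc))

∑-+ : ∀ {n} (f g : Fin n → ℕ) → ∑ (λ v → f v + g v) ≡ ∑ f + ∑ g
∑-+ {zero}  f g = refl
∑-+ {suc n} f g = trans (cong (f zero + g zero +_) (∑-+ (f ∘ suc) (g ∘ suc)))
                        (interchange (f zero) (g zero) (∑ (f ∘ suc)) (∑ (g ∘ suc)))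

∑-const : ∀ {n} k → ∑ {n} (λ _ → k) ≡ n * k
∑-const {zero}  k = refl
∑-const {suc n} k = cong (k +_) (∑-const {n} k)

∑-zero : ∀ {n} → ∑ {n} (λ _ → 0) ≡ 0
∑-zero {n} = trans (∑-const {n} 0) (*-zeroʳ n)

∑-↦ : ∀ {n} (a : Fin n) d → ∑ (a ↦ d) ≡ d
∑-↦ {suc n} zero    d = trans (cong (d +_) (∑-zero {n})) (+-identityʳ d)
∑-↦ {suc n} (suc a) d = ∑-↦ a d

↦-away : ∀ {n} {a v : Fin n} d → v ≢ a → (a ↦ d) v ≡ 0
↦-away {a = a} {v} d v≢a with v ≟ a
... | yes v≡a = contradiction v≡a v≢a
... | no _    = refl

∑-gains : ∀ {n} (f g : Fin n → ℕ) (ps : List (Fin n × ℕ)) →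
  AllPairs (λ p q → proj₁ p ≢ proj₁ q) ps → (∀ v → f v ≤ g v) →
  All (λ p → f (proj₁ p) + proj₂ p ≤ g (proj₁ p)) ps → ∑ f + sum (map proj₂ ps) ≤ ∑ g
∑-gains f g []             _            f≤g []             =
  ≤-trans (≤-reflexive (+-identityʳ (∑ f))) (∑-mono-≤ f≤g)
∑-gains f g ((a , d) ∷ ps) (a∉ps ∷ ps!) f≤g (gain ∷ gains) = begin
  ∑ f + (d + sum (map proj₂ ps))        ≡⟨ +-assoc (∑ f) d _ ⟨
  ∑ f + d + sum (map proj₂ ps)          ≡⟨ cong (λ t → ∑ f + t + _) (∑-↦ a d) ⟨
  ∑ f + ∑ (a ↦ d) + sum (map proj₂ ps)  ≡⟨ cong (_+ sum (map proj₂ ps)) (∑-+ f (a ↦ d)) ⟨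
  ∑ f′ + sum (map proj₂ ps)             ≤⟨ ∑-gains f′ g ps ps! f′≤g (gains′ a∉ps gains) ⟩
  ∑ g                                   ∎
  where
  open ≤-Reasoning
  f′ : Fin _ → ℕ
  f′ v = f v + (a ↦ d) v
  f′≤g : ∀ v → f′ v ≤ g v
  f′≤g v with v ≟ a
  ... | yes refl = gain
  ... | no _     = ≤-trans (≤-reflexive (+-identityʳ (f v))) (f≤g v)
  f′-away : ∀ {b} → a ≢ b → f′ b ≡ f b
  f′-away {b} a≢b = trans (cong (f b +_) (↦-away d (a≢b ∘ sym))) (+-identityʳ (f b))
  gains′ : ∀ {qs} → All (λ q → a ≢ proj₁ q) qs →
           All (λ q → f (proj₁ q) + proj₂ q ≤ g (proj₁ q)) qs →
           All (λ q → f′ (proj₁ q) + proj₂ q ≤ g (proj₁ q)) qs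
  gains′ []             []             = []
  gains′ (a≢b ∷ a∉qs) (gain ∷ gains) =
    subst (λ t → t + _ ≤ _) (sym (f′-away a≢b)) gain ∷ gains′ a∉qs gains

∑-positive : ∀ {n} (f : Fin n → ℕ) → 1 ≤ ∑ f → ∃[ v ] 1 ≤ f v
∑-positive {suc n} f 1≤∑f with f zero in eq
... | suc _ = zero , subst (1 ≤_) (sym eq) (s≤s z≤n)
... | zero  = let v , 1≤fv = ∑-positive (f ∘ suc) 1≤∑f in suc v , 1≤fv

∣tabulate∣≡∑ : ∀ {n} (S : Fin n → Bool) → ∣ tabulate S ∣ ≡ ∑ (fromBool ∘ S)
∣tabulate∣≡∑ {zero}  S = refl
∣tabulate∣≡∑ {suc n} S with S zero
... | true  = cong suc (∣tabulate∣≡∑ (S ∘ suc))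
... | false = ∣tabulate∣≡∑ (S ∘ suc)

infixl 6 _∪ᴸ_

-- Opaque, so that (C ∪ᴸ vs) v is rigid and the implicit C and vs below can be inferred.
opaque
  _∪ᴸ_ : ∀ {n} → (Fin n → Bool) → List (Fin n) → Fin n → Bool
  (C ∪ᴸ vs) v = C v ∨ does (any? (v ≟_) vs)

  ∪ᴸ-inj₁ : ∀ {n} {C : Fin n → Bool} {v} vs → C v ≡ true → (C ∪ᴸ vs) v ≡ true
  ∪ᴸ-inj₁ vs Cv rewrite Cv = refl

  ∪ᴸ-inj₂ : ∀ {n} {C : Fin n → Bool} {v vs} → v ∈ vs → (C ∪ᴸ vs) v ≡ true
  ∪ᴸ-inj₂ {C = C} {v} {vs} v∈vs with any? (v ≟_) vs
  ... | yes _     = ∨-zeroʳ (C v)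
  ... | no  v∉vs = contradiction v∈vs v∉vs

  ∪ᴸ⁻ : ∀ {n} {C : Fin n → Bool} {v} vs → (C ∪ᴸ vs) v ≡ true → C v ≡ true ⊎ v ∈ vs
  ∪ᴸ⁻ {C = C} {v} vs h with C v | any? (v ≟_) vs
  ... | true  | _         = inj₁ refl
  ... | false | yes v∈vs = inj₂ v∈vs

  ∑-∪ᴸ : ∀ {n} (C : Fin n → Bool) vs → ∑ (fromBool ∘ (C ∪ᴸ vs)) ≤ ∑ (fromBool ∘ C) + length vs
  ∑-∪ᴸ C [] = begin
    ∑ (fromBool ∘ (C ∪ᴸ []))  ≤⟨ ∑-mono-≤ (λ v → ≤-reflexive (cong fromBool (∨-identityʳ (C v)))) ⟩
    ∑ (fromBool ∘ C)          ≡⟨ +-identityʳ _ ⟨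
    ∑ (fromBool ∘ C) + 0      ∎
    where open ≤-Reasoning
  ∑-∪ᴸ C (p ∷ vs) = begin
    ∑ (fromBool ∘ (C ∪ᴸ (p ∷ vs)))                ≤⟨ ∑-mono-≤ (λ v → fromBool-∨-∨ (C v) (does (v ≟ p)) _) ⟩
    ∑ (λ v → fromBool ((C ∪ᴸ vs) v) + (p ↦ 1) v)  ≡⟨ ∑-+ (fromBool ∘ (C ∪ᴸ vs)) (p ↦ 1) ⟩
    ∑ (fromBool ∘ (C ∪ᴸ vs)) + ∑ (p ↦ 1)          ≡⟨ cong (∑ (fromBool ∘ (C ∪ᴸ vs)) +_) (∑-↦ p 1) ⟩
    ∑ (fromBool ∘ (C ∪ᴸ vs)) + 1                  ≤⟨ +-monoˡ-≤ 1 (∑-∪ᴸ C vs) ⟩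
    ∑ (fromBool ∘ C) + length vs + 1              ≡⟨ +-assoc (∑ (fromBool ∘ C)) (length vs) 1 ⟩
    ∑ (fromBool ∘ C) + (length vs + 1)            ≡⟨ cong (∑ (fromBool ∘ C) +_) (+-comm (length vs) 1) ⟩
    ∑ (fromBool ∘ C) + suc (length vs)            ∎
    where
    open ≤-Reasoning
    fromBool-∨-∨ : ∀ a b c → fromBool (a ∨ (b ∨ c)) ≤ fromBool (a ∨ c) + fromBool b
    fromBool-∨-∨ true  b     c = s≤s z≤n
    fromBool-∨-∨ false true  c = m≤n+m 1 (fromBool c)
    fromBool-∨-∨ false false c = m≤m+n (fromBool c) 0

coloured≢uncoloured : ∀ {n} {C : Fin n → Bool} {a b} → C a ≡ true → C b ≡ false → a ≢ b
coloured≢uncoloured a∈C b∉C refl with trans (sym a∈C) b∉C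
... | ()

complete-or-uncoloured : ∀ {n} (C : Fin n → Bool) → (∀ v → C v ≡ true) ⊎ ∃[ v ] C v ≡ false
complete-or-uncoloured {n} C with Fin.all? (λ v → C v B.≟ true)
... | yes complete  = inj₁ complete
... | no incomplete =
  let v , v∉C = Fin.¬∀⟶∃¬ n _ (λ v → C v B.≟ true) incomplete in inj₂ (v , ¬-not v∉C)

module GraphProperties {n} (G : Graph n) where

  Adj-sym : ∀ {u v} → Adj G u v → Adj G v u
  Adj-sym {u} {v} uv = trans (Graph.sym G v u) uv

  Adj⇒≢ : ∀ {u v} → Adj G u v → u ≢ v
  Adj⇒≢ {u} uu refl with trans (sym uu) (irrefl G u)
  ... | ()

  ¬Adj : ∀ {u v} → adj G u v ≡ false → ¬ Adj G u v
  ¬Adj u≁v u∼v with trans (sym u≁v) u∼v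
  ... | ()

  boundary-edge : ∀ (C : Fin n → Bool) {a v} → Reach G a v → C a ≡ true → C v ≡ false →
    ∃[ x ] ∃[ y ] C x ≡ true × Adj G x y × C y ≡ false
  boundary-edge C here              a∈C a∉C = contradiction refl (coloured≢uncoloured {C = C} a∈C a∉C)
  boundary-edge C (step {u} a⇝u uv) a∈C v∉C with C u in u∈C
  ... | true  = u , _ , u∈C , uv , v∉C
  ... | false = boundary-edge C a⇝u a∈C u∈C

  K4-free : Set
  K4-free = ∀ {a b c d} →
    Adj G a b → Adj G a c → Adj G a d → Adj G b c → Adj G b d → Adj G c d → ⊥

  record Neighbours (v a b c : Fin n) : Set where
    field
      adj₁ : Adj G v a
      adj₂ : Adj G v b
      adj₃ : Adj G v c
      a≢b  : a ≢ b
      a≢c  : a ≢ c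
      b≢c  : b ≢ c
      only : ∀ {u} → Adj G v u → u ≡ a ⊎ u ≡ b ⊎ u ≡ c

  module _ {v a b c : Fin n} (N : Neighbours v a b c) where
    open Neighbours N

    Neighbours-all : ∀ {p} (P : Fin n → Set p) → P a → P b → P c → ∀ u → Adj G v u → P u
    Neighbours-all P Pa Pb Pc u vu with only vu
    ... | inj₁ refl        = Pa
    ... | inj₂ (inj₁ refl) = Pb
    ... | inj₂ (inj₂ refl) = Pc

    Neighbours-others : ∀ {p} (P : Fin n → Set p) → P a → P b → ∀ u → Adj G v u → u ≢ c → P u
    Neighbours-others P Pa Pb u vu u≢c with only vu
    ... | inj₁ refl        = Pa
    ... | inj₂ (inj₁ refl) = Pb
    ... | inj₂ (inj₂ u≡c)  = contradiction u≡c u≢c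

    Neighbours-swapˡ : Neighbours v b a c
    Neighbours-swapˡ = record
      { adj₁ = adj₂ ; adj₂ = adj₁ ; adj₃ = adj₃ ; a≢b = a≢b ∘ sym ; a≢c = b≢c ; b≢c = a≢c
      ; only = λ vu → [ inj₂ ∘ inj₁ , [ inj₁ , inj₂ ∘ inj₂ ]′ ]′ (only vu) }

    Neighbours-swapʳ : Neighbours v a c b
    Neighbours-swapʳ = record
      { adj₁ = adj₁ ; adj₂ = adj₃ ; adj₃ = adj₂ ; a≢b = a≢c ; a≢c = a≢b ; b≢c = b≢c ∘ sym
      ; only = λ vu → [ inj₁ , (λ u≡b|c → inj₂ ([ inj₂ , inj₁ ]′ u≡b|c)) ]′ (only vu) }

    force₃ : ∀ {S} → Colored G S v → Colored G S a → Colored G S b → Colored G S c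
    force₃ Cv Ca Cb = force Cv adj₃ (Neighbours-others (Colored G _) Ca Cb)

module CubicProperties {n} (G : Graph n) (cubic : Cubic G) where
  open GraphProperties G

  ∑adj≡3 : ∀ v → ∑ (fromBool ∘ adj G v) ≡ 3
  ∑adj≡3 v = trans (sym (∣tabulate∣≡∑ (adj G v))) (cubic v)

  ¬four-neighbours : ∀ {v a b c d} → Adj G v a → Adj G v b → Adj G v c → Adj G v d →
    a ≢ b → a ≢ c → a ≢ d → b ≢ c → b ≢ d → c ≢ d → ⊥
  ¬four-neighbours {v} {a} {b} {c} {d} va vb vc vd a≢b a≢c a≢d b≢c b≢d c≢d with
    ∑-gains (λ _ → 0) (fromBool ∘ adj G v) ((a , 1) ∷ (b , 1) ∷ (c , 1) ∷ (d , 1) ∷ [])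
      ((a≢b ∷ a≢c ∷ a≢d ∷ []) ∷ (b≢c ∷ b≢d ∷ []) ∷ (c≢d ∷ []) ∷ [] ∷ [])
      (λ _ → z≤n) (adjacent va ∷ adjacent vb ∷ adjacent vc ∷ adjacent vd ∷ [])
    where
    adjacent : ∀ {u} → Adj G v u → 1 ≤ fromBool (adj G v u)
    adjacent vu rewrite vu = ≤-refl
  ... | 4≤3 rewrite ∑-zero {n} | ∑adj≡3 v with 4≤3
  ...   | s≤s (s≤s (s≤s ()))

  fresh-neighbour : ∀ v (L : List (Fin n)) → length L < 3 → ∃[ u ] Adj G v u × u ∉ L
  fresh-neighbour v L ∣L∣<3 with Fin.any? (λ u → (adj G v u B.≟ true) ×-dec ¬? (any? (u ≟_) L))
  ... | yes found = found
  ... | no  none  = contradiction 3≤∣L∣ (<⇒≱ ∣L∣<3)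
    where
    adj⊆L : ∀ u → fromBool (adj G v u) ≤ fromBool ((const false ∪ᴸ L) u)
    adj⊆L u with adj G v u in vu | any? (u ≟_) L
    ... | false | _        = z≤n
    ... | true  | yes u∈L = ≤-reflexive (cong fromBool (sym (∪ᴸ-inj₂ u∈L)))
    ... | true  | no  u∉L = contradiction (u , vu , u∉L) none
    3≤∣L∣ : 3 ≤ length L
    3≤∣L∣ = begin
      3                                  ≡⟨ ∑adj≡3 v ⟨
      ∑ (fromBool ∘ adj G v)             ≤⟨ ∑-mono-≤ adj⊆L ⟩
      ∑ (fromBool ∘ (const false ∪ᴸ L))  ≤⟨ ∑-∪ᴸ (const false) L ⟩
      ∑ {n} (λ _ → 0) + length L         ≡⟨ cong (_+ length L) (∑-zero {n}) ⟩
      length L                           ∎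
      where open ≤-Reasoning

  neighbours : ∀ {v a b c} → Adj G v a → Adj G v b → Adj G v c → a ≢ b → a ≢ c → b ≢ c →
    Neighbours v a b c
  neighbours {v} {a} {b} {c} va vb vc a≢b a≢c b≢c = record
    { adj₁ = va ; adj₂ = vb ; adj₃ = vc ; a≢b = a≢b ; a≢c = a≢c ; b≢c = b≢c ; only = only }
    where
    only : ∀ {u} → Adj G v u → u ≡ a ⊎ u ≡ b ⊎ u ≡ c
    only {u} vu with u ≟ a | u ≟ b | u ≟ c
    ... | yes u≡a | _       | _       = inj₁ u≡a
    ... | no _    | yes u≡b | _       = inj₂ (inj₁ u≡b)
    ... | no _    | no _    | yes u≡c = inj₂ (inj₂ u≡c)
    ... | no u≢a  | no u≢b  | no u≢c  =
      ⊥-elim (¬four-neighbours va vb vc vu a≢b a≢c (u≢a ∘ sym) b≢c (u≢b ∘ sym) (u≢c ∘ sym))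

  third-neighbour : ∀ {v a b} → Adj G v a → Adj G v b → a ≢ b → ∃[ c ] Neighbours v a b c
  third-neighbour {v} {a} {b} va vb a≢b =
    let c , vc , c∉ab = fresh-neighbour v (a ∷ b ∷ []) (s≤s (s≤s (s≤s z≤n)))
    in  c , neighbours va vb vc a≢b (c∉ab ∘ here ∘ sym) (c∉ab ∘ there ∘ here ∘ sym)

  some-neighbours : ∀ v → ∃[ a ] ∃[ b ] ∃[ c ] Neighbours v a b c
  some-neighbours v =
    let a , va , _   = fresh-neighbour v [] (s≤s z≤n)
        b , vb , b∉a = fresh-neighbour v (a ∷ []) (s≤s (s≤s z≤n))
        c , N        = third-neighbour va vb (b∉a ∘ here ∘ sym)
    in  a , b , c , N

  K4-subgraph⇒IsK4 : Connected G → ∀ {a b c d} →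
    Adj G a b → Adj G a c → Adj G a d → Adj G b c → Adj G b d → Adj G c d → IsK4 G
  K4-subgraph⇒IsK4 connected {a} {b} {c} {d} ab ac ad bc bd cd =
    ↔-sym (⤖⇒↔ (mk⤖ (from-injective , λ v → index v , λ { refl → from-index v }))) ,
    λ u v → mk⇔ (λ uv i≡j → Adj⇒≢ uv (trans (sym (from-index u)) (trans (cong from i≡j) (from-index v))))
                (λ i≢j → subst₂ (Adj G) (from-index u) (from-index v) (from-adj i≢j))
    where
    from : Fin 4 → Fin n
    from 0F = a
    from 1F = b
    from 2F = c
    from 3F = d

    from-adj : ∀ {i j} → i ≢ j → Adj G (from i) (from j)
    from-adj {0F} {0F} i≢j = contradiction refl i≢j
    from-adj {0F} {1F} _   = ab
    from-adj {0F} {2F} _   = ac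
    from-adj {0F} {3F} _   = ad
    from-adj {1F} {0F} _   = Adj-sym ab
    from-adj {1F} {1F} i≢j = contradiction refl i≢j
    from-adj {1F} {2F} _   = bc
    from-adj {1F} {3F} _   = bd
    from-adj {2F} {0F} _   = Adj-sym ac
    from-adj {2F} {1F} _   = Adj-sym bc
    from-adj {2F} {2F} i≢j = contradiction refl i≢j
    from-adj {2F} {3F} _   = cd
    from-adj {3F} {0F} _   = Adj-sym ad
    from-adj {3F} {1F} _   = Adj-sym bd
    from-adj {3F} {2F} _   = Adj-sym cd
    from-adj {3F} {3F} i≢j = contradiction refl i≢j

    from-injective : ∀ {i j} → from i ≡ from j → i ≡ j
    from-injective {i} {j} e with i ≟ j
    ... | yes i≡j = i≡j
    ... | no  i≢j = contradiction e (Adj⇒≢ (from-adj i≢j))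

    Neighbours-from : ∀ i j k l → i ≢ j → i ≢ k → i ≢ l → j ≢ k → j ≢ l → k ≢ l →
      Neighbours (from i) (from j) (from k) (from l)
    Neighbours-from i j k l i≢j i≢k i≢l j≢k j≢l k≢l =
      neighbours (from-adj i≢j) (from-adj i≢k) (from-adj i≢l)
        (Adj⇒≢ (from-adj j≢k)) (Adj⇒≢ (from-adj j≢l)) (Adj⇒≢ (from-adj k≢l))

    among : ∀ {v j k l w} → Neighbours v (from j) (from k) (from l) → Adj G v w → ∃[ i ] from i ≡ w
    among {j = j} {k} {l} N vw =
      [ (λ e → j , sym e) , [ (λ e → k , sym e) , (λ e → l , sym e) ]′ ]′ (Neighbours.only N vw)

    from-closed : ∀ i {w} → Adj G (from i) w → ∃[ j ] from j ≡ w
    from-closed 0F = among (Neighbours-from 0F 1F 2F 3F (λ ()) (λ ()) (λ ()) (λ ()) (λ ()) (λ ()))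
    from-closed 1F = among (Neighbours-from 1F 0F 2F 3F (λ ()) (λ ()) (λ ()) (λ ()) (λ ()) (λ ()))
    from-closed 2F = among (Neighbours-from 2F 0F 1F 3F (λ ()) (λ ()) (λ ()) (λ ()) (λ ()) (λ ()))
    from-closed 3F = among (Neighbours-from 3F 0F 1F 2F (λ ()) (λ ()) (λ ()) (λ ()) (λ ()) (λ ()))

    reached : ∀ {v} → Reach G a v → ∃[ i ] from i ≡ v
    reached here          = 0F , refl
    reached (step a⇝u uv) with reached a⇝u
    ... | i , refl = from-closed i uv

    index : Fin n → Fin 4
    index v = proj₁ (reached (connected a v))

    from-index : ∀ v → from (index v) ≡ v
    from-index v = proj₂ (reached (connected a v))

module _ {n} {G : Graph n} where

  Colored-seed : ∀ {S : Fin n → Bool} {v} → S v ≡ true → Colored G (tabulate S) v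
  Colored-seed {S} {v} Sv = init (lookup⇒[]= v (tabulate S) (trans (lookup∘tabulate S v) Sv))

  Colored-mono : ∀ {S S′ : Fin n → Bool} → (∀ {v} → S v ≡ true → S′ v ≡ true) →
    ∀ {v} → Colored G (tabulate S) v → Colored G (tabulate S′) v
  Colored-mono {S} {S′} S⊆S′ (init {v} v∈S) =
    Colored-seed (S⊆S′ (trans (sym (lookup∘tabulate S v)) ([]=⇒lookup v∈S)))
  Colored-mono S⊆S′ (force Cu uv others) =
    force (Colored-mono S⊆S′ Cu) uv (λ w uw w≢v → Colored-mono S⊆S′ (others w uw w≢v))

module Potential {n} (G : Graph n) where

  Saturated : (Fin n → Bool) → Fin n → Set
  Saturated C v = ∀ u → Adj G v u → C u ≡ true

  saturated? : ∀ C v → Dec (Saturated C v)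
  saturated? C v = Fin.all? (λ u → (adj G v u B.≟ true) →-dec (C u B.≟ true))

  -- Opaque for the same reason as _∪ᴸ_.
  opaque
    ψ : (Fin n → Bool) → Fin n → ℕ
    ψ C v = if C v then (if does (saturated? C v) then 2 else 1) else 0

    ψ≤2 : ∀ C v → ψ C v ≤ 2
    ψ≤2 C v with C v | does (saturated? C v)
    ... | true  | true  = ≤-refl
    ... | true  | false = s≤s z≤n
    ... | false | _     = z≤n

    ψ-uncoloured : ∀ {C v} → C v ≡ false → ψ C v ≡ 0
    ψ-uncoloured v∉C rewrite v∉C = refl

    ψ-coloured : ∀ {C v} → C v ≡ true → 1 ≤ ψ C v
    ψ-coloured {C} {v} v∈C rewrite v∈C with does (saturated? C v)
    ... | true  = s≤s z≤n
    ... | false = s≤s z≤n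

    ψ-unsaturated : ∀ {C v} → ¬ Saturated C v → ψ C v ≤ 1
    ψ-unsaturated {C} {v} unsat rewrite dec-false (saturated? C v) unsat with C v
    ... | true  = ≤-refl
    ... | false = z≤n

    ψ-saturated : ∀ {C v} → C v ≡ true → Saturated C v → ψ C v ≡ 2
    ψ-saturated {C} {v} v∈C sat rewrite v∈C | dec-true (saturated? C v) sat = refl

  ψ-mono : ∀ {C C′} → (∀ {v} → C v ≡ true → C′ v ≡ true) → ∀ v → ψ C v ≤ ψ C′ v
  ψ-mono {C} {C′} C⊆C′ v with C v in v∈C
  ... | false = ≤-trans (≤-reflexive (ψ-uncoloured v∈C)) z≤n
  ... | true with saturated? C v
  ...   | yes sat  = ≤-reflexive (trans (ψ-saturated v∈C sat)
                                        (sym (ψ-saturated (C⊆C′ v∈C) (λ u vu → C⊆C′ (sat u vu)))))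
  ...   | no  ¬sat = ≤-trans (ψ-unsaturated ¬sat) (ψ-coloured (C⊆C′ v∈C))

  Φ : (Fin n → Bool) → ℕ
  Φ C = ∑ (ψ C)

  gain-colour : ∀ {C C′ v} → C v ≡ false → C′ v ≡ true → ψ C v + 1 ≤ ψ C′ v
  gain-colour {C} v∉C v∈C′ rewrite ψ-uncoloured {C} v∉C = ψ-coloured v∈C′

  gain-colour-saturate : ∀ {C C′ v} → C v ≡ false → C′ v ≡ true → Saturated C′ v →
    ψ C v + 2 ≤ ψ C′ v
  gain-colour-saturate {C} {C′} v∉C v∈C′ sat
    rewrite ψ-uncoloured {C} v∉C | ψ-saturated {C′} v∈C′ sat = ≤-refl

  gain-saturate : ∀ {C C′ v u} → Adj G v u → C u ≡ false → C′ v ≡ true → Saturated C′ v →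
    ψ C v + 1 ≤ ψ C′ v
  gain-saturate {C} {C′} vu u∉C v∈C′ sat rewrite ψ-saturated {C′} v∈C′ sat =
    +-monoˡ-≤ 1 (ψ-unsaturated {C} λ C⊇Nv → contradiction (trans (sym (C⊇Nv _ vu)) u∉C) λ ())

  coloured-exists : ∀ {C} → 1 ≤ Φ C → ∃[ v ] C v ≡ true
  coloured-exists {C} 1≤Φ with ∑-positive (ψ C) 1≤Φ
  ... | v , 1≤ψ with C v in v∈C
  ...   | true  = v , v∈C
  ...   | false = contradiction (≤-trans 1≤ψ (≤-reflexive (ψ-uncoloured v∈C))) λ ()

  Φ-incomplete : ∀ {C v} → C v ≡ false → Φ C + 2 ≤ 2 * n
  Φ-incomplete {C} {v} v∉C = begin
    Φ C + 2          ≤⟨ ∑-gains (ψ C) (λ _ → 2) ((v , 2) ∷ []) ([] ∷ []) (ψ≤2 C)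
                          (≤-reflexive (cong (_+ 2) (ψ-uncoloured v∉C)) ∷ []) ⟩
    ∑ {n} (λ _ → 2)  ≡⟨ ∑-const {n} 2 ⟩
    n * 2            ≡⟨ *-comm n 2 ⟩
    2 * n            ∎
    where open ≤-Reasoning

  Φ-complete : ∀ {C} → (∀ v → C v ≡ true) → Φ C ≡ 2 * n
  Φ-complete complete =
    trans (sum-cong-≗ (λ v → ψ-saturated (complete v) (λ u _ → complete u)))
          (trans (∑-const {n} 2) (*-comm n 2))

  Φ-empty : Φ (const false) ≡ 0
  Φ-empty = trans (sum-cong-≗ (λ v → ψ-uncoloured {const false} {v} refl)) (∑-zero {n})

  Φ-gains : ∀ {C C′} → (∀ {v} → C v ≡ true → C′ v ≡ true) → (ps : List (Fin n × ℕ)) →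
    AllPairs (λ p q → proj₁ p ≢ proj₁ q) ps → All (λ p → ψ C (proj₁ p) + proj₂ p ≤ ψ C′ (proj₁ p)) ps →
    Φ C + sum (map proj₂ ps) ≤ Φ C′
  Φ-gains C⊆C′ ps distinct = ∑-gains _ _ ps distinct (ψ-mono C⊆C′)

module Forcing {n} (G : Graph n) where
  open GraphProperties G
  open Potential G

  Anchor : (Fin n → Bool) → Fin n → Set
  Anchor C v = ∃[ u ] Adj G v u × C u ≡ true

  record State : Set where
    field
      seeds coloured : Fin n → Bool
      sound    : ∀ {v} → coloured v ≡ true → Colored G (tabulate seeds) v
      anchored : ∀ {v} → coloured v ≡ true → Anchor coloured v

  open State public

  size : State → ℕ
  size st = ∑ (fromBool ∘ seeds st)

  sound⁺ : ∀ st T {v} → coloured st v ≡ true → Colored G (tabulate (seeds st ∪ᴸ T)) v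
  sound⁺ st T = Colored-mono (∪ᴸ-inj₁ T) ∘ sound st

  extend : (st : State) (T vs : List (Fin n)) → All (Colored G (tabulate (seeds st ∪ᴸ T))) vs →
    All (Anchor (coloured st ∪ᴸ vs)) vs → State
  extend st T vs colour anchor = record
    { seeds    = seeds st ∪ᴸ T
    ; coloured = coloured st ∪ᴸ vs
    ; sound    = λ v∈C′ → [ sound⁺ st T , All.lookup colour ]′ (∪ᴸ⁻ vs v∈C′)
    ; anchored = λ v∈C′ → [ old-anchor , All.lookup anchor ]′ (∪ᴸ⁻ vs v∈C′)
    }
    where
    old-anchor : ∀ {v} → coloured st v ≡ true → Anchor (coloured st ∪ᴸ vs) v
    old-anchor v∈C = let u , vu , u∈C = anchored st v∈C in u , vu , ∪ᴸ-inj₁ vs u∈C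

  size-extend : ∀ st T vs colour anchor → size (extend st T vs colour anchor) ≤ size st + length T
  size-extend st T vs _ _ = ∑-∪ᴸ (seeds st) T

  anchor-at : ∀ {C : Fin n → Bool} {u v} → Adj G u v → C u ≡ true → Anchor C v
  anchor-at uv u∈C = _ , Adj-sym uv , u∈C

  empty : State
  empty = record { seeds = const false ; coloured = const false ; sound = λ () ; anchored = λ () }

  ForceMove : (Fin n → Bool) → Set
  ForceMove C = ∃[ u ] ∃[ v ]
    C u ≡ true × Adj G u v × C v ≡ false × (∀ w → Adj G u w → w ≢ v → C w ≡ true)

  forceMove? : ∀ C → Dec (ForceMove C)
  forceMove? C = Fin.any? λ u → Fin.any? λ v →
    (C u B.≟ true) ×-dec (adj G u v B.≟ true) ×-dec (C v B.≟ false) ×-dec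
    Fin.all? (λ w → (adj G u w B.≟ true) →-dec ¬? (w ≟ v) →-dec (C w B.≟ true))

  force-step : (st : State) → ForceMove (coloured st) →
    Σ State λ st′ → size st′ ≤ size st + 0 × Φ (coloured st) + 2 ≤ Φ (coloured st′)
  force-step st (u , v , u∈C , uv , v∉C , others) = st′ , size-extend st [] (v ∷ []) colour anchor , gain
    where
    C′ : Fin n → Bool
    C′ = coloured st ∪ᴸ (v ∷ [])
    colour : All (Colored G (tabulate (seeds st ∪ᴸ []))) (v ∷ [])
    colour = force (sound⁺ st [] u∈C) uv (λ w uw w≢v → sound⁺ st [] (others w uw w≢v)) ∷ []
    anchor : All (Anchor C′) (v ∷ [])
    anchor = anchor-at uv (∪ᴸ-inj₁ _ u∈C) ∷ []
    st′ : State
    st′ = extend st [] (v ∷ []) colour anchor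
    v∈C′ : C′ v ≡ true
    v∈C′ = ∪ᴸ-inj₂ (here refl)
    u-saturated : Saturated C′ u
    u-saturated w uw with w ≟ v
    ... | yes refl = v∈C′
    ... | no  w≢v  = ∪ᴸ-inj₁ _ (others w uw w≢v)
    gain : Φ (coloured st) + 2 ≤ Φ C′
    gain = Φ-gains (∪ᴸ-inj₁ _) ((u , 1) ∷ (v , 1) ∷ []) ((coloured≢uncoloured u∈C v∉C ∷ []) ∷ [] ∷ [])
             (gain-saturate uv v∉C (∪ᴸ-inj₁ _ u∈C) u-saturated ∷ gain-colour v∉C v∈C′ ∷ [])

  stuck⇒uncoloured : ∀ {C u a v w} → ¬ ForceMove C → Neighbours u a v w →
    C u ≡ true → C a ≡ true → C v ≡ false → C w ≡ false
  stuck⇒uncoloured {C} {w = w} stuck N u∈C a∈C v∉C with C w in w∈C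
  ... | false = refl
  ... | true  = contradiction
    (_ , _ , u∈C , Neighbours.adj₂ N , v∉C ,
     Neighbours-others (Neighbours-swapʳ N) (λ t → C t ≡ true) a∈C w∈C)
    stuck

module Steps {n} (G : Graph n) (cubic : Cubic G) where
  open GraphProperties G
  open CubicProperties G cubic
  open Potential G
  open Forcing G

  Advance : State → Set
  Advance st = Σ State λ st′ → size st′ ≤ size st + 1 × Φ (coloured st) + 6 ≤ Φ (coloured st′)

  module _ (st : State) {x w y z} (Nx : Neighbours x w y z) (x∈C : coloured st x ≡ true)
           (w∈C : coloured st w ≡ true) (y∉C : coloured st y ≡ false) (z∉C : coloured st z ≡ false) where

    private
      C : Fin n → Bool
      C = coloured st
      open Neighbours Nx
        renaming (adj₁ to xw; adj₂ to xy; adj₃ to xz; a≢b to w≢y; a≢c to w≢z; b≢c to y≢z)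

      x≢w : x ≢ w
      x≢w = Adj⇒≢ xw
      x≢y : x ≢ y
      x≢y = Adj⇒≢ xy
      x≢z : x ≢ z
      x≢z = Adj⇒≢ xz

      Colouring : List (Fin n) → Fin n → Bool
      Colouring extra = C ∪ᴸ (y ∷ z ∷ extra)

      old : ∀ {extra v} → C v ≡ true → Colouring extra v ≡ true
      old = ∪ᴸ-inj₁ _

      y∈ : ∀ {extra} → Colouring extra y ≡ true
      y∈ = ∪ᴸ-inj₂ (here refl)

      z∈ : ∀ {extra} → Colouring extra z ≡ true
      z∈ = ∪ᴸ-inj₂ (there (here refl))

      extra∈ : ∀ {extra v} → v ∈ extra → Colouring extra v ≡ true
      extra∈ = ∪ᴸ-inj₂ ∘ there ∘ there

      Seeded : Fin n → Set
      Seeded = Colored G (tabulate (seeds st ∪ᴸ (y ∷ [])))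

      was : ∀ {v} → C v ≡ true → Seeded v
      was = sound⁺ st (y ∷ [])

      y-seeded : Seeded y
      y-seeded = Colored-seed (∪ᴸ-inj₂ (here refl))

      z-forced : Seeded z
      z-forced = force₃ Nx (was x∈C) (was w∈C) y-seeded

      x-gain : ∀ {extra} → ψ C x + 1 ≤ ψ (Colouring extra) x
      x-gain = gain-saturate xy y∉C (old x∈C) (Neighbours-all Nx _ (old w∈C) y∈ z∈)

      advance-with : ∀ extra → All Seeded extra → All (Anchor (Colouring extra)) extra →
        Φ C + 6 ≤ Φ (Colouring extra) → Advance st
      advance-with extra colour anchor gain =
        extend st (y ∷ []) (y ∷ z ∷ extra) colour′ anchor′ , size-extend st _ _ colour′ anchor′ , gain
        where
        colour′ : All Seeded (y ∷ z ∷ extra)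
        colour′ = y-seeded ∷ z-forced ∷ colour
        anchor′ : All (Anchor (Colouring extra)) (y ∷ z ∷ extra)
        anchor′ = anchor-at xy (old x∈C) ∷ anchor-at xz (old x∈C) ∷ anchor

    advance-triangle-xyz : Adj G y z → Advance st
    advance-triangle-xyz yz
      with third-neighbour (Adj-sym xy) yz x≢z | third-neighbour (Adj-sym xz) (Adj-sym yz) x≢y
    ... | y′ , Ny | z′ , Nz = by-colour-of-y′ (C y′) refl
      where
      open Neighbours Ny using () renaming (adj₃ to yy′; a≢c to x≢y′; b≢c to z≢y′)
      y′∈ : ∀ {extra} → Colouring (y′ ∷ z′ ∷ extra) y′ ≡ true
      y′∈ = extra∈ (here refl)
      z′∈ : ∀ {extra} → Colouring (y′ ∷ z′ ∷ extra) z′ ≡ true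
      z′∈ = extra∈ (there (here refl))

      conclude : ∀ extra → All Seeded extra → All (Anchor (Colouring (y′ ∷ z′ ∷ extra))) extra →
        ψ C y′ + 1 ≤ ψ (Colouring (y′ ∷ z′ ∷ extra)) y′ → Advance st
      conclude extra colour anchor y′-gain = advance-with (y′ ∷ z′ ∷ extra)
        (force₃ Ny y-seeded (was x∈C) z-forced ∷ force₃ Nz z-forced (was x∈C) y-seeded ∷ colour)
        (anchor-at yy′ y∈ ∷ anchor-at (Neighbours.adj₃ Nz) z∈ ∷ anchor)
        (Φ-gains old ((x , 1) ∷ (y , 2) ∷ (z , 2) ∷ (y′ , 1) ∷ [])
          ((x≢y ∷ x≢z ∷ x≢y′ ∷ []) ∷ (y≢z ∷ Adj⇒≢ yy′ ∷ []) ∷ (z≢y′ ∷ []) ∷ [] ∷ [])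
          ( x-gain
          ∷ gain-colour-saturate y∉C y∈ (Neighbours-all Ny _ (old x∈C) z∈ y′∈)
          ∷ gain-colour-saturate z∉C z∈ (Neighbours-all Nz _ (old x∈C) y∈ z′∈)
          ∷ y′-gain ∷ []))

      -- A coloured y′ has a coloured neighbour q, and forcing its last neighbour p saturates it.
      by-colour-of-y′ : ∀ b → C y′ ≡ b → Advance st
      by-colour-of-y′ false y′∉C = conclude [] [] [] (gain-colour y′∉C y′∈)
      by-colour-of-y′ true  y′∈C =
        let q , y′q , q∈C = anchored st y′∈C
            p , Ny′       = third-neighbour y′q (Adj-sym yy′) (coloured≢uncoloured q∈C y∉C)
        in  conclude (p ∷ []) (force₃ Ny′ (was y′∈C) (was q∈C) y-seeded ∷ [])
              (anchor-at (Neighbours.adj₃ Ny′) (old y′∈C) ∷ [])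
              (gain-saturate (Adj-sym yy′) y∉C (old y′∈C)
                 (Neighbours-all Ny′ _ (old q∈C) y∈ (extra∈ (there (there (here refl))))))

    advance-diamond-xw : Adj G w y → Adj G w z → Advance st
    advance-diamond-xw wy wz
      with third-neighbour (Adj-sym xy) (Adj-sym wy) x≢w | third-neighbour (Adj-sym xz) (Adj-sym wz) x≢w
    ... | y′ , Ny | z′ , Nz = advance-with (y′ ∷ z′ ∷ [])
      (force₃ Ny y-seeded (was x∈C) (was w∈C) ∷ force₃ Nz z-forced (was x∈C) (was w∈C) ∷ [])
      (anchor-at (Neighbours.adj₃ Ny) y∈ ∷ anchor-at (Neighbours.adj₃ Nz) z∈ ∷ [])
      (Φ-gains old ((x , 1) ∷ (w , 1) ∷ (y , 2) ∷ (z , 2) ∷ [])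
        ((x≢w ∷ x≢y ∷ x≢z ∷ []) ∷ (w≢y ∷ w≢z ∷ []) ∷ (y≢z ∷ []) ∷ [] ∷ [])
        ( x-gain
        ∷ gain-saturate wy y∉C (old w∈C) (Neighbours-all Nw _ (old x∈C) y∈ z∈)
        ∷ gain-colour-saturate y∉C y∈ (Neighbours-all Ny _ (old x∈C) (old w∈C) (extra∈ (here refl)))
        ∷ gain-colour-saturate z∉C z∈
            (Neighbours-all Nz _ (old x∈C) (old w∈C) (extra∈ (there (here refl))))
        ∷ []))
      where
      Nw : Neighbours w x y z
      Nw = neighbours (Adj-sym xw) wy wz (coloured≢uncoloured x∈C y∉C) (coloured≢uncoloured x∈C z∉C) y≢z

    advance-triangle-xwy : ¬ ForceMove C → Adj G w y → ¬ Adj G w z → Advance st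
    advance-triangle-xwy stuck wy w≁z
      with third-neighbour (Adj-sym xw) wy x≢y | third-neighbour (Adj-sym xy) (Adj-sym wy) x≢w
    ... | w′ , Nw | y′ , Ny = advance-with (w′ ∷ y′ ∷ [])
      (force₃ Nw (was w∈C) (was x∈C) y-seeded ∷ force₃ Ny y-seeded (was x∈C) (was w∈C) ∷ [])
      (anchor-at ww′ (old w∈C) ∷ anchor-at (Neighbours.adj₃ Ny) y∈ ∷ [])
      (Φ-gains old ((x , 1) ∷ (y , 2) ∷ (z , 1) ∷ (w , 1) ∷ (w′ , 1) ∷ [])
        ( (x≢y ∷ x≢z ∷ x≢w ∷ coloured≢uncoloured x∈C w′∉C ∷ [])
        ∷ (y≢z ∷ w≢y ∘ sym ∷ Neighbours.b≢c Nw ∷ [])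
        ∷ (w≢z ∘ sym ∷ (λ z≡w′ → w≁z (subst (Adj G w) (sym z≡w′) ww′)) ∷ [])
        ∷ (Adj⇒≢ ww′ ∷ []) ∷ [] ∷ [])
        ( x-gain
        ∷ gain-colour-saturate y∉C y∈
            (Neighbours-all Ny _ (old x∈C) (old w∈C) (extra∈ (there (here refl))))
        ∷ gain-colour z∉C z∈
        ∷ gain-saturate wy y∉C (old w∈C) (Neighbours-all Nw _ (old x∈C) y∈ (extra∈ (here refl)))
        ∷ gain-colour w′∉C (extra∈ (here refl))
        ∷ []))
      where
      ww′ : Adj G w w′
      ww′ = Neighbours.adj₃ Nw
      w′∉C : C w′ ≡ false
      w′∉C = stuck⇒uncoloured stuck Nw w∈C x∈C y∉C

  advance : ClawFree G → (st : State) → ¬ ForceMove (coloured st) →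
    ∀ {x y} → coloured st x ≡ true → Adj G x y → coloured st y ≡ false → Advance st
  advance claw-free st stuck x∈C xy y∉C =
    let w , xw , w∈C = anchored st x∈C
        z , Nx       = third-neighbour xw xy (coloured≢uncoloured w∈C y∉C)
    in  by-cases Nx x∈C w∈C y∉C (stuck⇒uncoloured stuck Nx x∈C w∈C y∉C)
    where
    by-cases : ∀ {x w y z} → Neighbours x w y z → coloured st x ≡ true → coloured st w ≡ true →
      coloured st y ≡ false → coloured st z ≡ false → Advance st
    by-cases {x} {w} {y} {z} Nx x∈C w∈C y∉C z∉C
      with adj G y z in yz | adj G w y in wy | adj G w z in wz
    ... | true  | _     | _     = advance-triangle-xyz st Nx x∈C w∈C y∉C z∉C yz
    ... | false | true  | true  = advance-diamond-xw st Nx x∈C w∈C y∉C z∉C wy wz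
    ... | false | true  | false = advance-triangle-xwy st Nx x∈C w∈C y∉C z∉C stuck wy (¬Adj wz)
    ... | false | false | true  =
      advance-triangle-xwy st (Neighbours-swapʳ Nx) x∈C w∈C z∉C y∉C stuck wz (¬Adj wy)
    ... | false | false | false =
      ⊥-elim (claw-free x w y z adj₁ adj₂ adj₃ a≢b a≢c b≢c (¬Adj wy , ¬Adj wz , ¬Adj yz))
      where open Neighbours Nx

  Start : Set
  Start = Σ State λ st → size st ≤ 3 × 9 ≤ Φ (coloured st)

  -- With seeds x, p, r, the vertex x forces q, and then p and q force p′ and q′.
  module StartTriangle {x p q r p′ q′} (Nx : Neighbours x p q r) (pq : Adj G p q)
           (Np : Neighbours p x q p′) (Nq : Neighbours q x p q′) where

    private
      T : List (Fin n)
      T = x ∷ p ∷ r ∷ []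
      Seeded : Fin n → Set
      Seeded = Colored G (tabulate (seeds empty ∪ᴸ T))

      open Neighbours Nx using ()
        renaming (adj₁ to xp; adj₂ to xq; adj₃ to xr; a≢b to p≢q; a≢c to p≢r; b≢c to q≢r)
      x≢p : x ≢ p
      x≢p = Adj⇒≢ xp
      x≢q : x ≢ q
      x≢q = Adj⇒≢ xq
      x≢r : x ≢ r
      x≢r = Adj⇒≢ xr
      open Neighbours Np using () renaming (adj₃ to pp′; a≢c to x≢p′; b≢c to q≢p′)
      open Neighbours Nq using () renaming (adj₃ to qq′; a≢c to x≢q′; b≢c to p≢q′)

      x-seeded : Seeded x
      x-seeded = Colored-seed (∪ᴸ-inj₂ (here refl))
      p-seeded : Seeded p
      p-seeded = Colored-seed (∪ᴸ-inj₂ (there (here refl)))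
      r-seeded : Seeded r
      r-seeded = Colored-seed (∪ᴸ-inj₂ (there (there (here refl))))
      q-forced : Seeded q
      q-forced = force₃ (Neighbours-swapʳ Nx) x-seeded p-seeded r-seeded
      p′-forced : Seeded p′
      p′-forced = force₃ Np p-seeded x-seeded q-forced

      Colouring : List (Fin n) → Fin n → Bool
      Colouring extra = const false ∪ᴸ (x ∷ p ∷ r ∷ q ∷ p′ ∷ q′ ∷ extra)

      x∈ : ∀ {extra} → Colouring extra x ≡ true
      x∈ = ∪ᴸ-inj₂ (here refl)
      p∈ : ∀ {extra} → Colouring extra p ≡ true
      p∈ = ∪ᴸ-inj₂ (there (here refl))
      r∈ : ∀ {extra} → Colouring extra r ≡ true
      r∈ = ∪ᴸ-inj₂ (there (there (here refl)))
      q∈ : ∀ {extra} → Colouring extra q ≡ true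
      q∈ = ∪ᴸ-inj₂ (there (there (there (here refl))))
      p′∈ : ∀ {extra} → Colouring extra p′ ≡ true
      p′∈ = ∪ᴸ-inj₂ (there (there (there (there (here refl)))))
      q′∈ : ∀ {extra} → Colouring extra q′ ≡ true
      q′∈ = ∪ᴸ-inj₂ (there (there (there (there (there (here refl))))))
      extra∈ : ∀ {extra v} → v ∈ extra → Colouring extra v ≡ true
      extra∈ = ∪ᴸ-inj₂ ∘ there ∘ there ∘ there ∘ there ∘ there ∘ there

      x-gain : ∀ {extra} → ψ (const false) x + 2 ≤ ψ (Colouring extra) x
      x-gain = gain-colour-saturate refl x∈ (Neighbours-all Nx _ p∈ q∈ r∈)
      p-gain : ∀ {extra} → ψ (const false) p + 2 ≤ ψ (Colouring extra) p
      p-gain = gain-colour-saturate refl p∈ (Neighbours-all Np _ x∈ q∈ p′∈)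
      q-gain : ∀ {extra} → ψ (const false) q + 2 ≤ ψ (Colouring extra) q
      q-gain = gain-colour-saturate refl q∈ (Neighbours-all Nq _ x∈ p∈ q′∈)

      start-with : ∀ extra → All Seeded extra → All (Anchor (Colouring extra)) extra →
        Φ (const false) + 9 ≤ Φ (Colouring extra) → Start
      start-with extra colour anchor gain =
        st , ≤-trans (size-extend empty T vs colour′ anchor′) (≤-reflexive (cong (_+ 3) (∑-zero {n}))) ,
        subst (λ Φ₀ → Φ₀ + 9 ≤ Φ (Colouring extra)) Φ-empty gain
        where
        vs : List (Fin n)
        vs = x ∷ p ∷ r ∷ q ∷ p′ ∷ q′ ∷ extra
        colour′ : All Seeded vs
        colour′ = x-seeded ∷ p-seeded ∷ r-seeded ∷ q-forced
                ∷ p′-forced ∷ force₃ Nq q-forced x-seeded p-seeded ∷ colour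
        anchor′ : All (Anchor (Colouring extra)) vs
        anchor′ = anchor-at (Adj-sym xp) p∈ ∷ anchor-at xp x∈ ∷ anchor-at xr x∈ ∷ anchor-at xq x∈
                ∷ anchor-at pp′ p∈ ∷ anchor-at qq′ q∈ ∷ anchor
        st : State
        st = extend empty T vs colour′ anchor′

    start-p′≡r : p′ ≡ r → q′ ≢ r → Start
    start-p′≡r p′≡r q′≢r
      with third-neighbour (Adj-sym xr) (Adj-sym (subst (Adj G p) p′≡r pp′)) x≢p
    ... | r′ , Nr = start-with (r′ ∷ []) (force₃ Nr r-seeded x-seeded p-seeded ∷ [])
      (anchor-at (Neighbours.adj₃ Nr) r∈ ∷ [])
      (Φ-gains (λ ()) ((x , 2) ∷ (p , 2) ∷ (q , 2) ∷ (r , 2) ∷ (q′ , 1) ∷ [])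
        ( (x≢p ∷ x≢q ∷ x≢r ∷ x≢q′ ∷ []) ∷ (p≢q ∷ p≢r ∷ p≢q′ ∷ []) ∷ (q≢r ∷ Adj⇒≢ qq′ ∷ [])
        ∷ (q′≢r ∘ sym ∷ []) ∷ [] ∷ [])
        ( x-gain ∷ p-gain ∷ q-gain
        ∷ gain-colour-saturate refl r∈ (Neighbours-all Nr _ x∈ p∈ (extra∈ (here refl)))
        ∷ gain-colour refl q′∈ ∷ []))

    start-p′≡q′ : p′ ≡ q′ → p′ ≢ r → Start
    start-p′≡q′ p′≡q′ p′≢r
      with third-neighbour (Adj-sym pp′) (Adj-sym (subst (Adj G q) (sym p′≡q′) qq′)) p≢q
    ... | t , Np′ = start-with (t ∷ []) (force₃ Np′ p′-forced p-seeded q-forced ∷ [])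
      (anchor-at (Neighbours.adj₃ Np′) p′∈ ∷ [])
      (Φ-gains (λ ()) ((x , 2) ∷ (p , 2) ∷ (q , 2) ∷ (r , 1) ∷ (p′ , 2) ∷ [])
        ( (x≢p ∷ x≢q ∷ x≢r ∷ x≢p′ ∷ []) ∷ (p≢q ∷ p≢r ∷ Adj⇒≢ pp′ ∷ []) ∷ (q≢r ∷ q≢p′ ∷ [])
        ∷ (p′≢r ∘ sym ∷ []) ∷ [] ∷ [])
        ( x-gain ∷ p-gain ∷ q-gain ∷ gain-colour refl r∈
        ∷ gain-colour-saturate refl p′∈ (Neighbours-all Np′ _ p∈ q∈ (extra∈ (here refl))) ∷ []))

    start-distinct : p′ ≢ r → q′ ≢ r → p′ ≢ q′ → Start
    start-distinct p′≢r q′≢r p′≢q′ = start-with [] [] []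
      (Φ-gains (λ ()) ((x , 2) ∷ (p , 2) ∷ (q , 2) ∷ (r , 1) ∷ (p′ , 1) ∷ (q′ , 1) ∷ [])
        ( (x≢p ∷ x≢q ∷ x≢r ∷ x≢p′ ∷ x≢q′ ∷ []) ∷ (p≢q ∷ p≢r ∷ Adj⇒≢ pp′ ∷ p≢q′ ∷ [])
        ∷ (q≢r ∷ q≢p′ ∷ Adj⇒≢ qq′ ∷ []) ∷ (p′≢r ∘ sym ∷ q′≢r ∘ sym ∷ []) ∷ (p′≢q′ ∷ []) ∷ [] ∷ [])
        ( x-gain ∷ p-gain ∷ q-gain
        ∷ gain-colour refl r∈ ∷ gain-colour refl p′∈ ∷ gain-colour refl q′∈ ∷ []))

  start-triangle : K4-free → ∀ {x p q r} → Neighbours x p q r → Adj G p q → Start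
  start-triangle no-K4 {r = r} Nx pq
    with third-neighbour (Adj-sym (Neighbours.adj₁ Nx)) pq (Adj⇒≢ (Neighbours.adj₂ Nx))
       | third-neighbour (Adj-sym (Neighbours.adj₂ Nx)) (Adj-sym pq) (Adj⇒≢ (Neighbours.adj₁ Nx))
  ... | p′ , Np | q′ , Nq with p′ ≟ r | q′ ≟ r
  ... | yes refl | yes refl =
    ⊥-elim (no-K4 (Neighbours.adj₁ Nx) (Neighbours.adj₂ Nx) (Neighbours.adj₃ Nx) pq
                  (Neighbours.adj₃ Np) (Neighbours.adj₃ Nq))
  ... | yes p′≡r | no  q′≢r = StartTriangle.start-p′≡r Nx pq Np Nq p′≡r q′≢r
  ... | no  p′≢r | yes q′≡r = StartTriangle.start-p′≡r (Neighbours-swapˡ Nx) (Adj-sym pq) Nq Np q′≡r p′≢r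
  ... | no  p′≢r | no  q′≢r with p′ ≟ q′
  ...   | yes p′≡q′ = StartTriangle.start-p′≡q′ Nx pq Np Nq p′≡q′ p′≢r
  ...   | no  p′≢q′ = StartTriangle.start-distinct Nx pq Np Nq p′≢r q′≢r p′≢q′

  start : ClawFree G → K4-free → Fin n → Start
  start claw-free no-K4 x with some-neighbours x
  ... | a , b , c , Nx with adj G a b in ab | adj G a c in ac | adj G b c in bc
  ... | true  | _     | _     = start-triangle no-K4 Nx ab
  ... | false | true  | _     = start-triangle no-K4 (Neighbours-swapʳ Nx) ac
  ... | false | false | true  = start-triangle no-K4 (Neighbours-swapʳ (Neighbours-swapˡ Nx)) bc
  ... | false | false | false =
    ⊥-elim (claw-free x a b c adj₁ adj₂ adj₃ a≢b a≢c b≢c (¬Adj ab , ¬Adj ac , ¬Adj bc))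
    where open Neighbours Nx

-- The three initial seeds only guarantee Φ ≥ 9, too little for 5 · 3 ≤ Φ + 5; one more seed
-- brings Φ ≥ 15, which suffices.
Good : ℕ → ℕ → Set
Good s P = 9 ≤ P × (s ≤ 3 ⊎ 5 * s ≤ P + 5)

Good-force : ∀ {s s′ P P′} → s′ ≤ s + 0 → P + 2 ≤ P′ → Good s P → Good s′ P′
Good-force {s} {s′} {P} {P′} s′≤s+0 P+2≤P′ (9≤P , small⊎bounded) =
  ≤-trans 9≤P P≤P′ ,
  Sum.map (≤-trans s′≤s) (λ 5s≤P+5 → ≤-trans (*-monoʳ-≤ 5 s′≤s) (≤-trans 5s≤P+5 (+-monoˡ-≤ 5 P≤P′)))
          small⊎bounded
  where
  P≤P′ : P ≤ P′
  P≤P′ = ≤-trans (m≤m+n P 2) P+2≤P′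
  s′≤s : s′ ≤ s
  s′≤s = ≤-trans s′≤s+0 (≤-reflexive (+-identityʳ s))

Good-advance : ∀ {s s′ P P′} → s′ ≤ s + 1 → P + 6 ≤ P′ → Good s P → Good s′ P′
Good-advance {s} {s′} {P} {P′} s′≤s+1 P+6≤P′ (9≤P , small⊎bounded) =
  ≤-trans 9≤P (≤-trans (m≤m+n P 6) P+6≤P′) , inj₂ (bounded small⊎bounded)
  where
  open ≤-Reasoning
  bounded : s ≤ 3 ⊎ 5 * s ≤ P + 5 → 5 * s′ ≤ P′ + 5
  bounded (inj₁ s≤3) = begin
    5 * s′     ≤⟨ *-monoʳ-≤ 5 (≤-trans s′≤s+1 (+-monoˡ-≤ 1 s≤3)) ⟩
    20         ≤⟨ +-monoˡ-≤ 5 (+-monoˡ-≤ 6 9≤P) ⟩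
    P + 6 + 5  ≤⟨ +-monoˡ-≤ 5 P+6≤P′ ⟩
    P′ + 5     ∎
  bounded (inj₂ 5s≤P+5) = begin
    5 * s′       ≤⟨ *-monoʳ-≤ 5 s′≤s+1 ⟩
    5 * (s + 1)  ≡⟨ *-distribˡ-+ 5 s 1 ⟩
    5 * s + 5    ≤⟨ +-monoˡ-≤ 5 5s≤P+5 ⟩
    P + 5 + 5    ≤⟨ +-monoˡ-≤ 5 (≤-trans (+-monoʳ-≤ P (n≤1+n 5)) P+6≤P′) ⟩
    P′ + 5       ∎

Good⇒bound : ∀ {s m} → Good s (2 * m) → 5 * s ≤ 2 * m + 5
Good⇒bound         (_     , inj₂ bounded) = bounded
Good⇒bound {s} {m} (9≤2m , inj₁ s≤3)     = begin
  5 * s      ≤⟨ *-monoʳ-≤ 5 s≤3 ⟩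
  15         ≤⟨ +-monoˡ-≤ 5 (*-monoʳ-≤ 2 (*-cancelˡ-< 2 4 m 9≤2m)) ⟩  -- 9 ≤ 2 * m forces 4 < m
  2 * m + 5  ∎
  where open ≤-Reasoning

module Run {n} (G : Graph n) (connected : Connected G) (claw-free : ClawFree G) (cubic : Cubic G)
           (no-K4 : GraphProperties.K4-free G) where
  open GraphProperties G
  open Potential G
  open Forcing G
  open Steps G cubic

  GoodState : State → Set
  GoodState st = Good (size st) (Φ (coloured st))

  progress : (st : State) → GoodState st → ∃[ v ] coloured st v ≡ false →
    Σ State λ st′ → GoodState st′ × Φ (coloured st) + 2 ≤ Φ (coloured st′)
  progress st good (v , v∉C) with forceMove? (coloured st)
  ... | yes move =
    let st′ , size≤ , gain = force-step st move in st′ , Good-force size≤ gain good , gain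
  ... | no stuck =
    let a , a∈C                = coloured-exists (≤-trans (s≤s z≤n) (proj₁ good))
        x , y , x∈C , xy , y∉C = boundary-edge (coloured st) (connected a v) a∈C v∉C
        st′ , size≤ , gain     = advance claw-free st stuck x∈C xy y∉C
    in  st′ , Good-advance size≤ gain good , ≤-trans (+-monoʳ-≤ _ (s≤s (s≤s z≤n))) gain

  run : (k : ℕ) (st : State) → GoodState st → 2 * n ≤ Φ (coloured st) + k →
    Σ State λ st′ → GoodState st′ × (∀ v → coloured st′ v ≡ true)
  run k st good bound with complete-or-uncoloured (coloured st)
  ... | inj₁ complete = st , good , complete
  run zero st good bound | inj₂ (v , v∉C) with
    +-cancelˡ-≤ (Φ (coloured st)) 2 0 (≤-trans (Φ-incomplete v∉C) bound)
  ... | ()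
  run (suc k) st good bound | inj₂ uncoloured =
    let st′ , good′ , gain = progress st good uncoloured
    in  run k st′ good′ (begin
          2 * n                       ≤⟨ bound ⟩
          Φ (coloured st) + suc k     ≡⟨ +-suc (Φ (coloured st)) k ⟩
          suc (Φ (coloured st)) + k   ≤⟨ +-monoˡ-≤ k (≤-trans (m≤n+m _ 1) (≤-reflexive (+-comm 2 _))) ⟩
          Φ (coloured st) + 2 + k     ≤⟨ +-monoˡ-≤ k gain ⟩
          Φ (coloured st′) + k        ∎)
    where open ≤-Reasoning

  zero-forcing-set : Fin n → Σ (Subset n) λ S → IsZeroForcingSet G S × 5 * ∣ S ∣ ≤ 2 * n + 5
  zero-forcing-set x =
    let st₀ , size≤3 , 9≤Φ  = start claw-free no-K4 x
        st , good , complete = run (2 * n) st₀ (9≤Φ , inj₁ size≤3) (m≤n+m (2 * n) (Φ (coloured st₀)))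
    in  tabulate (seeds st) , (λ v → sound st (complete v)) ,
        subst (λ s → 5 * s ≤ 2 * n + 5) (sym (∣tabulate∣≡∑ (seeds st)))
          (Good⇒bound {m = n} (subst (Good (size st)) (Φ-complete complete) good))

corollary3p2 : (n : ℕ) (G : Graph n) → Connected G → ClawFree G → Cubic G →
    ¬ IsK4 G →
    Σ (Subset n) λ S → IsZeroForcingSet G S × 5 * ∣ S ∣ ≤ 2 * n + 5
corollary3p2 zero    G _         _         _     _   = [] , (λ ()) , z≤n
corollary3p2 (suc m) G connected claw-free cubic ¬K4 =
  Run.zero-forcing-set G connected claw-free cubic no-K4 zero
  where
  no-K4 : GraphProperties.K4-free G
  no-K4 ab ac ad bc bd cd = ¬K4 (CubicProperties.K4-subgraph⇒IsK4 G cubic connected ab ac ad bc bd cd)
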